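{- Let $\chi$ and $\check\phi$ be formulas over $\vec{x}$ and $\vec{a}:\mathbb{Z}^d\to\mathbb{Z}^d$ such that for all $\vec{x}\in\mathbb{Z}^d$: $\check\phi(\vec{x})\land\chi(\vec{a}(\vec{x}))\implies\chi(\vec{x})$. Then the conditional acceleration technique $(\langle\chi,\vec{a}\rangle,\check\phi)\mapsto \vec{x}'=\vec{a}^n(\vec{x})\land\chi(\vec{a}^{n-1}(\vec{x}))$ (defined on all such pairs) is exact. Explicitly: for all $\vec{x},\vec{x}'\in\mathbb{Z}^d$ and $n>0$, (i) if $\vec{x}\longrightarrow^n_{\langle\check\phi,\vec{a}\rangle}\vec{x}'$, $\vec{x}'=\vec{a}^n(\vec{x})$ and $\chi(\vec{a}^{n-1}(\vec{x}))$, then $\vec{x}\longrightarrow^n_{\langle\chi,\vec{a}\rangle}\vec{x}'$; and (ii) if $\vec{x}\longrightarrow^n_{\langle\chi\land\check\phi,\vec{a}\rangle}\vec{x}'$, then $\vec{x}'=\vec{a}^n(\vec{x})$ and $\chi(\vec{a}^{n-1}(\vec{x}))$.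
   Context: $\vec{x}=(x_1,\dots,x_d)$ ranges over $\mathbb{Z}^d$, $n$ is a variable, $\vec{x}'=(x_1',\dots,x_d')$. Formulas are finite quantifier-free propositional formulas with atoms $p>0$, $p$ a closed-form arithmetic expression. For a formula $\phi$ over $\vec{x}$ and $\vec{a}:\mathbb{Z}^d\to\mathbb{Z}^d$, the loop $\langle\phi,\vec{a}\rangle$ induces $\vec{x}\longrightarrow_{\langle\phi,\vec{a}\rangle}\vec{x}'$ iff $\phi(\vec{x})\land\vec{x}'=\vec{a}(\vec{x})$; $\longrightarrow^n$ is its $n$-fold composition, and $\vec{a}^n$ is the $n$-fold application of $\vec{a}$ ($\vec{a}^0=\mathrm{id}$). A conditional acceleration technique is a partial function $\mathit{accel}$ mapping pairs (loop $\langle\chi,\vec{a}\rangle$, formula $\check\phi$) to formulas over $(\vec{x},n,\vec{x}')$; it is sound if for all arguments in its domain, $\vec{x},\vec{x}'\in\mathbb{Z}^d$, $n>0$: $\vec{x}\longrightarrow^n_{\langle\check\phi,\vec{a}\rangle}\vec{x}'\land\mathit{accel}(\langle\chi,\vec{a}\rangle,\check\phi)$ implies $\vec{x}\longrightarrow^n_{\langle\chi,\vec{a}\rangle}\vec{x}'$; exact if additionally $\vec{x}\longrightarrow^n_{\langle\chi\land\check\phi,\vec{a}\rangle}\vec{x}'$ implies $\mathit{accel}(\langle\chi,\vec{a}\rangle,\check\phi)$. -}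

module Defs where

open import Data.Nat using (ℕ; zero; suc; _∸_; _>_)
open import Data.Integer using (ℤ; +_; _<_)
open import Data.Vec using (Vec)
open import Data.Product using (_×_; Σ; ∃)
open import Data.Sum using (_⊎_)
open import Data.Empty using (⊥)
open import Data.Unit using (⊤)
open import Relation.Binary.PropositionalEquality using (_≡_)

Pt : ℕ → Set
Pt d = Vec ℤ d

-- Quantifier-free propositional formulas over x⃗ with atoms  p > 0,
-- where p (a closed-form arithmetic expression) is modelled by its
-- denotation, an arbitrary function ℤ^d → ℤ.
data Formula (d : ℕ) : Set where
  atom : (Pt d → ℤ) → Formula d
  ⊤ᶠ ⊥ᶠ : Formula d
  _∧ᶠ_ _∨ᶠ_ : Formula d → Formula d → Formula d
  ¬ᶠ_ : Formula d → Formula d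

⟦_⟧ : ∀ {d} → Formula d → Pt d → Set
⟦ atom p ⟧ x = + 0 < p x
⟦ ⊤ᶠ ⟧ x = ⊤
⟦ ⊥ᶠ ⟧ x = ⊥
⟦ φ ∧ᶠ ψ ⟧ x = ⟦ φ ⟧ x × ⟦ ψ ⟧ x
⟦ φ ∨ᶠ ψ ⟧ x = ⟦ φ ⟧ x ⊎ ⟦ ψ ⟧ x
⟦ ¬ᶠ φ ⟧ x = ⟦ φ ⟧ x → ⊥

record Loop (d : ℕ) : Set where
  constructor ⟨_,_⟩
  field
    guard  : Formula d
    update : Pt d → Pt d
open Loop public

Step : ∀ {d} → Loop d → Pt d → Pt d → Set
Step L x x' = ⟦ guard L ⟧ x × x' ≡ update L x

Steps : ∀ {d} → Loop d → ℕ → Pt d → Pt d → Set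
Steps L zero x x' = x ≡ x'
Steps {d} L (suc n) x x' = Σ (Pt d) λ y → Step L x y × Steps L n y x'

iter : ∀ {d} → (Pt d → Pt d) → ℕ → Pt d → Pt d
iter a zero x = x
iter a (suc n) x = a (iter a n x)

-- Relational meaning of a formula over (x⃗, n, x⃗') produced by an
-- acceleration technique.
Rel3 : ℕ → Set₁
Rel3 d = Pt d → ℕ → Pt d → Set

record AccelTechnique (d : ℕ) : Set₁ where
  field
    Dom   : Loop d → Formula d → Set
    accel : (L : Loop d) (φ̌ : Formula d) → Dom L φ̌ → Rel3 d
open AccelTechnique public

Sound : ∀ {d} → AccelTechnique d → Set
Sound {d} T = ∀ χ a φ̌ (dom : Dom T ⟨ χ , a ⟩ φ̌) (x x' : Pt d) (n : ℕ) → n > 0 →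
  Steps ⟨ φ̌ , a ⟩ n x x' → accel T ⟨ χ , a ⟩ φ̌ dom x n x' →
  Steps ⟨ χ , a ⟩ n x x'

Exact : ∀ {d} → AccelTechnique d → Set
Exact {d} T = Sound T × (∀ χ a φ̌ (dom : Dom T ⟨ χ , a ⟩ φ̌) (x x' : Pt d) (n : ℕ) → n > 0 →
  Steps ⟨ χ ∧ᶠ φ̌ , a ⟩ n x x' → accel T ⟨ χ , a ⟩ φ̌ dom x n x')

backwardInvDom : ∀ {d} → Loop d → Formula d → Set
backwardInvDom {d} L φ̌ =
  ∀ (x : Pt d) → ⟦ φ̌ ⟧ x → ⟦ guard L ⟧ (update L x) → ⟦ guard L ⟧ x

backwardInvAccel : ∀ {d} → AccelTechnique d
backwardInvAccel = record
  { Dom = backwardInvDom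
  ; accel = λ L φ̌ _ x n x' →
      x' ≡ iter (update L) n x × ⟦ guard L ⟧ (iter (update L) (n ∸ 1) x)
  }

module Submission where

open import Data.Nat using (ℕ; zero; suc; _>_)
open import Data.Product using (_,_; proj₁)
open import Relation.Binary.PropositionalEquality using (_≡_; refl; sym; trans; cong; subst)
open import Defs

-- Whatever the guard, a run of length n from x visits x, a(x), …, a^n(x), which
-- gives exactness. For soundness a φ̌-run is turned into a χ-run from the back:
-- χ holds at a^{n-1}(x) by assumption, and φ̌(y) ∧ χ(a y) ⟹ χ(y) carries χ one
-- step further towards the start.

iter-suc′ : ∀ {d} (a : Pt d → Pt d) n x → iter a n (a x) ≡ iter a (suc n) x
iter-suc′ a zero    x = refl
iter-suc′ a (suc n) x = cong a (iter-suc′ a n x)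

Steps⇒≡iter : ∀ {d} {φ : Formula d} {a} n {x x'} → Steps ⟨ φ , a ⟩ n x x' → x' ≡ iter a n x
Steps⇒≡iter zero    x≡x'                       = sym x≡x'
Steps⇒≡iter (suc n) {x} (_ , (_ , refl) , run) = trans (Steps⇒≡iter n run) (iter-suc′ _ n x)

Steps-map-guard : ∀ {d} {φ ψ : Formula d} {a} → (∀ x → ⟦ φ ⟧ x → ⟦ ψ ⟧ x) →
  ∀ n {x x'} → Steps ⟨ φ , a ⟩ n x x' → Steps ⟨ ψ , a ⟩ n x x'
Steps-map-guard φ⇒ψ zero    x≡x'                 = x≡x'
Steps-map-guard φ⇒ψ (suc n) (y , (g , y≡) , run) = y , (φ⇒ψ _ g , y≡) , Steps-map-guard φ⇒ψ n run

Steps-guard-last : ∀ {d} {φ : Formula d} {a} m {x x'} →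
  Steps ⟨ φ , a ⟩ (suc m) x x' → ⟦ φ ⟧ (iter a m x)
Steps-guard-last zero    (_ , (g , _) , _)        = g
Steps-guard-last {φ = φ} (suc m) {x} (_ , (_ , refl) , run) =
  subst ⟦ φ ⟧ (iter-suc′ _ m x) (Steps-guard-last m run)

Steps-backward : ∀ {d} {χ φ̌ : Formula d} {a} → backwardInvDom ⟨ χ , a ⟩ φ̌ →
  ∀ m {x x'} → Steps ⟨ φ̌ , a ⟩ (suc m) x x' → ⟦ χ ⟧ (iter a m x) → Steps ⟨ χ , a ⟩ (suc m) x x'
Steps-backward inv zero    (y , (_ , y≡) , run) χ-last = y , (χ-last , y≡) , run
Steps-backward {χ = χ} {a = a} inv (suc m) {x} {x'} (_ , (g , refl) , run) χ-last =
  a x , (inv x g (first-guard run′) , refl) , run′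
  where
  run′ : Steps ⟨ χ , a ⟩ (suc m) (a x) x'
  run′ = Steps-backward inv m run (subst ⟦ χ ⟧ (sym (iter-suc′ a m x)) χ-last)
  first-guard : ∀ {k z z'} → Steps ⟨ χ , a ⟩ (suc k) z z' → ⟦ χ ⟧ z
  first-guard (_ , (g′ , _) , _) = g′

theorem7 : ∀ (d : ℕ) → Exact (backwardInvAccel {d})
theorem7 d = sound , complete
  where
  sound : Sound (backwardInvAccel {d})
  sound χ a φ̌ inv x x' (suc m) _ run (_ , χ-last) = Steps-backward inv m run χ-last

  complete : ∀ χ a φ̌ (inv : backwardInvDom ⟨ χ , a ⟩ φ̌) (x x' : Pt d) n → n > 0 →
    Steps ⟨ χ ∧ᶠ φ̌ , a ⟩ n x x' → accel backwardInvAccel ⟨ χ , a ⟩ φ̌ inv x n x'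
  complete χ a φ̌ _ x x' (suc m) _ run =
    Steps⇒≡iter (suc m) run , Steps-guard-last m (Steps-map-guard (λ _ → proj₁) (suc m) run)
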